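{- For any vertex-coloured graph $G^c$ with $c$ colours, $\gamma^t(G^c)\le \gamma(G)+c-1$, where $G$ is the underlying uncoloured graph. Furthermore, there are vertex-coloured graphs for which equality holds.
   Context: A vertex-coloured graph $G^c$ is a finite simple undirected graph $G$ in which each vertex receives exactly one colour from $\{1,\dots,c\}$ and every colour is used at least once. $\gamma(G)$ is the domination number (minimum size of a dominating set, i.e. a set $S$ with every vertex in $S$ or adjacent to $S$). A tropical dominating set is a dominating set containing at least one vertex of each colour; $\gamma^t(G^c)$ is the minimum size of a tropical dominating set. -}

module Defs where

open import Data.Nat using (ℕ; _≤_)
open import Data.Fin using (Fin)
open import Data.Fin.Subset using (Subset; _∈_; ∣_∣)
open import Data.Product using (Σ; ∃; _×_; ∃-syntax)
open import Data.Sum using (_⊎_)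
open import Relation.Binary.PropositionalEquality using (_≡_)
open import Relation.Nullary using (¬_)

record Graph (n : ℕ) : Set₁ where
  field
    Adj   : Fin n → Fin n → Set
    sym   : ∀ {u v} → Adj u v → Adj v u
    irrefl : ∀ {v} → ¬ Adj v v
open Graph public

record Colouring {n : ℕ} (G : Graph n) (c : ℕ) : Set where
  field
    col  : Fin n → Fin c
    surj : ∀ (i : Fin c) → ∃[ v ] col v ≡ i
open Colouring public

Dominating : ∀ {n} → Graph n → Subset n → Set
Dominating G S = ∀ v → v ∈ S ⊎ (∃[ u ] (u ∈ S × Adj G v u))

TropicalDominating : ∀ {n c} (G : Graph n) → Colouring G c → Subset n → Set
TropicalDominating {c = c} G κ S =
  Dominating G S × (∀ (i : Fin c) → ∃[ v ] (v ∈ S × col κ v ≡ i))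

IsDominationNumber : ∀ {n} → Graph n → ℕ → Set
IsDominationNumber G k =
  (∃[ S ] (Dominating G S × ∣ S ∣ ≡ k)) × (∀ S → Dominating G S → k ≤ ∣ S ∣)

IsTropicalDominationNumber : ∀ {n c} (G : Graph n) → Colouring G c → ℕ → Set
IsTropicalDominationNumber G κ k =
  (∃[ S ] (TropicalDominating G κ S × ∣ S ∣ ≡ k))
  × (∀ S → TropicalDominating G κ S → k ≤ ∣ S ∣)

module Submission where

-- Let D be a minimum dominating set.  If c ≥ 1 the graph has a
-- vertex, so D contains some vertex u.  Adding one representative vertex for
-- each of the c − 1 colours different from the colour of u gives a set that
-- still dominates (domination is upward closed) and now meets every colour.
-- It has at most |D| + (c − 1) elements, which bounds γᵗ.  The degenerate case
-- c = 0 forces the graph to be empty.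
--
-- In the complete graph on c ≥ 1 vertices, every single vertex
-- dominates, so γ = 1; with the rainbow colouring (every vertex its own colour,
-- on any graph) a tropical set must contain every vertex, so γᵗ = c = 1 + c − 1.

open import Defs
open import Data.Nat using (ℕ; _+_; _∸_; _≤_; _≥_)
open import Data.Product using (_×_; ∃-syntax)
open import Relation.Binary.PropositionalEquality using (_≡_)

open import Data.Nat using (zero; suc; s≤s; z≤n)
open import Data.Nat.Properties using (≤-trans; ≤-reflexive; +-suc; +-identityʳ; +-monoʳ-≤; n≤1+n; module ≤-Reasoning)
open import Data.Fin using (Fin; punchIn; punchOut) renaming (zero to fzero; suc to fsuc; _≟_ to _≟ᶠ_)
open import Data.Fin.Properties using (punchIn-punchOut)
open import Data.Fin.Subset using (Subset; _∈_; ∣_∣; _∪_; ⁅_⁆; _⊆_; ⊤; inside; outside)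
open import Data.Fin.Subset.Properties using (p⊆p∪q; q⊆p∪q; x∈⁅x⁆; x∈⁅y⁆⇒x≡y; ∣⁅x⁆∣≡1; ∣⊤∣≡n; ∈⊤; p⊆q⇒∣p∣≤∣q∣)
open import Data.Vec using ([]; _∷_)
open import Data.Product using (_,_; proj₁; proj₂)
open import Data.Sum using (inj₁; inj₂)
open import Relation.Binary.PropositionalEquality using (refl; trans; cong; subst) renaming (sym to ≡-sym)
open import Relation.Nullary using (yes; no; ¬_)

∣p∪q∣≤∣p∣+∣q∣ : ∀ {n} (p q : Subset n) → ∣ p ∪ q ∣ ≤ ∣ p ∣ + ∣ q ∣
∣p∪q∣≤∣p∣+∣q∣ []            []            = z≤n
∣p∪q∣≤∣p∣+∣q∣ (outside ∷ p) (outside ∷ q) = ∣p∪q∣≤∣p∣+∣q∣ p q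
∣p∪q∣≤∣p∣+∣q∣ (outside ∷ p) (inside  ∷ q) =
  ≤-trans (s≤s (∣p∪q∣≤∣p∣+∣q∣ p q)) (≤-reflexive (≡-sym (+-suc _ _)))
∣p∪q∣≤∣p∣+∣q∣ (inside  ∷ p) (outside ∷ q) = s≤s (∣p∪q∣≤∣p∣+∣q∣ p q)
∣p∪q∣≤∣p∣+∣q∣ (inside  ∷ p) (inside  ∷ q) =
  s≤s (≤-trans (∣p∪q∣≤∣p∣+∣q∣ p q) (+-monoʳ-≤ ∣ p ∣ (n≤1+n _)))

adjoin : ∀ {m n} → (Fin m → Fin n) → Subset n → Subset n
adjoin {zero}  f S = S
adjoin {suc m} f S = ⁅ f fzero ⁆ ∪ adjoin (λ j → f (fsuc j)) S

adjoin-size : ∀ {m n} (f : Fin m → Fin n) S → ∣ adjoin f S ∣ ≤ ∣ S ∣ + m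
adjoin-size {zero}  f S = ≤-reflexive (≡-sym (+-identityʳ ∣ S ∣))
adjoin-size {suc m} f S = begin
  ∣ ⁅ f fzero ⁆ ∪ rest ∣                ≤⟨ ∣p∪q∣≤∣p∣+∣q∣ ⁅ f fzero ⁆ rest ⟩
  ∣ ⁅ f fzero ⁆ ∣ + ∣ rest ∣      ≡⟨ cong (_+ ∣ rest ∣) (∣⁅x⁆∣≡1 (f fzero)) ⟩
  suc ∣ rest ∣                          ≤⟨ s≤s (adjoin-size (λ j → f (fsuc j)) S) ⟩
  suc (∣ S ∣ + m)                       ≡⟨ ≡-sym (+-suc ∣ S ∣ m) ⟩
  ∣ S ∣ + suc m                         ∎
  where
  open ≤-Reasoning
  rest : Subset _
  rest = adjoin (λ j → f (fsuc j)) S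

⊆-adjoin : ∀ {m n} (f : Fin m → Fin n) S → S ⊆ adjoin f S
⊆-adjoin {zero}  f S x∈S = x∈S
⊆-adjoin {suc m} f S x∈S = q⊆p∪q ⁅ f fzero ⁆ _ (⊆-adjoin (λ j → f (fsuc j)) S x∈S)

∈-adjoin : ∀ {m n} (f : Fin m → Fin n) S j → f j ∈ adjoin f S
∈-adjoin {suc m} f S fzero    = p⊆p∪q _ (x∈⁅x⁆ (f fzero))
∈-adjoin {suc m} f S (fsuc j) = q⊆p∪q ⁅ f fzero ⁆ _ (∈-adjoin (λ j → f (fsuc j)) S j)

∈⇒1≤∣p∣ : ∀ {n} {u : Fin n} {S : Subset n} → u ∈ S → 1 ≤ ∣ S ∣
∈⇒1≤∣p∣ {u = u} {S} u∈S =
  ≤-trans (≤-reflexive (≡-sym (∣⁅x⁆∣≡1 u))) (p⊆q⇒∣p∣≤∣q∣ ⁅u⁆⊆S)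
  where
  ⁅u⁆⊆S : ⁅ u ⁆ ⊆ S
  ⁅u⁆⊆S x∈⁅u⁆ rewrite x∈⁅y⁆⇒x≡y u x∈⁅u⁆ = u∈S

dominating-⊆ : ∀ {n} (G : Graph n) {S T} → S ⊆ T → Dominating G S → Dominating G T
dominating-⊆ G S⊆T dom v with dom v
... | inj₁ v∈S            = inj₁ (S⊆T v∈S)
... | inj₂ (u , u∈S , vu) = inj₂ (u , S⊆T u∈S , vu)

dominating-nonempty : ∀ {n} (G : Graph n) {S} → Dominating G S → Fin n → ∃[ u ] u ∈ S
dominating-nonempty G {S} dom v with dom v
... | inj₁ v∈S           = v , v∈S
... | inj₂ (u , u∈S , _) = u , u∈S

representative : ∀ {n c} {G : Graph n} → Colouring G c → Fin c → Fin n
representative κ i = proj₁ (surj κ i)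

tropical-extension : ∀ {n c} (G : Graph n) (κ : Colouring G c) D → Dominating G D →
  ∃[ T ] (TropicalDominating G κ T × ∣ T ∣ ≤ ∣ D ∣ + c ∸ 1)
tropical-extension {zero}  {zero}  G κ [] dom = [] , (dom , λ ()) , z≤n
tropical-extension {suc n} {zero}  G κ D  dom with col κ fzero
... | ()
tropical-extension {n}     {suc c} G κ D  dom =
  T , (dominating-⊆ G (⊆-adjoin others D) dom , meets-every-colour) , size
  where
  -- D is nonempty because the graph has a vertex of colour 0.
  some-u∈D : ∃[ u ] u ∈ D
  some-u∈D = dominating-nonempty G dom (representative κ fzero)

  u : Fin n
  u = proj₁ some-u∈D

  u∈D : u ∈ D
  u∈D = proj₂ some-u∈D

  k : Fin (suc c)
  k = col κ u

  -- representatives of the c colours other than k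
  others : Fin c → Fin n
  others j = representative κ (punchIn k j)

  T : Subset n
  T = adjoin others D

  meets-every-colour : ∀ i → ∃[ v ] (v ∈ T × col κ v ≡ i)
  meets-every-colour i with k ≟ᶠ i
  ... | yes k≡i = u , ⊆-adjoin others D u∈D , k≡i
  ... | no  k≢i = others (punchOut k≢i) , ∈-adjoin others D (punchOut k≢i) ,
                  trans (proj₂ (surj κ (punchIn k (punchOut k≢i)))) (punchIn-punchOut k≢i)

  size : ∣ T ∣ ≤ ∣ D ∣ + suc c ∸ 1
  size = ≤-trans (adjoin-size others D) (≤-reflexive (cong (_∸ 1) (≡-sym (+-suc ∣ D ∣ c))))

tropical-upper-bound : ∀ {n c} (G : Graph n) (κ : Colouring G c) (g t : ℕ) →
  IsDominationNumber G g → IsTropicalDominationNumber G κ t → t ≤ g + c ∸ 1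
tropical-upper-bound G κ g t ((D , dom , ∣D∣≡g) , _) (_ , t-minimal)
  with tropical-extension G κ D dom
... | T , trop , ∣T∣≤ =
  ≤-trans (t-minimal T trop) (subst (λ d → ∣ T ∣ ≤ d + _ ∸ 1) ∣D∣≡g ∣T∣≤)

complete : (n : ℕ) → Graph n
complete n = record
  { Adj    = λ u v → ¬ u ≡ v
  ; sym    = λ u≢v v≡u → u≢v (≡-sym v≡u)
  ; irrefl = λ v≢v → v≢v refl
  }

singleton-dominates : ∀ {n} (v : Fin n) → Dominating (complete n) ⁅ v ⁆
singleton-dominates v w with w ≟ᶠ v
... | yes refl = inj₁ (x∈⁅x⁆ v)
... | no  w≢v  = inj₂ (v , x∈⁅x⁆ v , w≢v)

complete-domination-number : ∀ n → IsDominationNumber (complete (suc n)) 1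
complete-domination-number n =
  (⁅ fzero ⁆ , singleton-dominates fzero , ∣⁅x⁆∣≡1 {suc n} fzero) ,
  λ S dom → ∈⇒1≤∣p∣ (proj₂ (dominating-nonempty (complete (suc n)) dom fzero))

rainbow : ∀ {n} (G : Graph n) → Colouring G n
rainbow G = record { col = λ v → v ; surj = λ i → i , refl }

rainbow-tropical-number : ∀ {n} (G : Graph n) → IsTropicalDominationNumber G (rainbow G) n
rainbow-tropical-number {n} G =
  (⊤ , ((λ v → inj₁ ∈⊤) , λ i → i , ∈⊤ , refl) , ∣⊤∣≡n n) ,
  λ S (_ , meets) → ≤-trans (≤-reflexive (≡-sym (∣⊤∣≡n n))) (p⊆q⇒∣p∣≤∣q∣ (⊤⊆ S meets))
  where
  ⊤⊆ : ∀ S → (∀ i → ∃[ v ] (v ∈ S × v ≡ i)) → ⊤ ⊆ S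
  ⊤⊆ S meets {x} _ with meets x
  ... | .x , x∈S , refl = x∈S

bound-is-sharp : ∀ c → c ≥ 1 →
  ∃[ n ] ∃[ G ] ∃[ κ ] ∃[ g ] ∃[ t ]
    (IsDominationNumber {n} G g × IsTropicalDominationNumber {n} {c} G κ t × t ≡ g + c ∸ 1)
bound-is-sharp (suc c) _ =
  suc c , complete (suc c) , rainbow (complete (suc c)) , 1 , suc c ,
  complete-domination-number c , rainbow-tropical-number (complete (suc c)) , refl

mainTheorem3 : (∀ {n c} (G : Graph n) (κ : Colouring G c) (g t : ℕ) →
    IsDominationNumber G g → IsTropicalDominationNumber G κ t →
    t ≤ g + c ∸ 1)
    ×
    (∀ (c : ℕ) → c ≥ 1 →
    ∃[ n ] ∃[ G ] ∃[ κ ] ∃[ g ] ∃[ t ]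
    (IsDominationNumber {n} G g × IsTropicalDominationNumber {n} {c} G κ t
    × t ≡ g + c ∸ 1))
mainTheorem3 = tropical-upper-bound , bound-is-sharp
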